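{- Let $\mathcal{J}$ be a small rigid category, i.e. a category whose objects have no non-identity automorphisms (for example a preorder or poset). Then the covariant isotropy group functor $\mathcal{Z}:\mathsf{Set}^{\mathcal{J}}\to\mathsf{Grp}$ is trivial.
   Context: $\mathsf{Set}^{\mathcal{J}}$ is the category of functors $\mathcal{J}\to\mathsf{Set}$. For a category $\mathcal{E}$ and object $X$, the covariant isotropy group $\mathcal{Z}(X)$ is the group of natural automorphisms of the projection functor $X/\mathcal{E}\to\mathcal{E}$, i.e. families of automorphisms $\alpha_m:Y\to Y$ for $m:X\to Y$ with $\alpha_{nm}\circ n=n\circ\alpha_m$ for all $n:Y\to Z$. Trivial means $\mathcal{Z}(F)$ is the trivial group for every $F$. -}

module Defs where

open import Level using (0ℓ)
open import Relation.Binary.PropositionalEquality using (_≡_; refl; trans; cong)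

record Category : Set₁ where
  infixr 9 _∘_
  field
    Obj       : Set
    Hom       : Obj → Obj → Set
    id        : ∀ {a} → Hom a a
    _∘_       : ∀ {a b c} → Hom b c → Hom a b → Hom a c
    identityˡ : ∀ {a b} (f : Hom a b) → id ∘ f ≡ f
    identityʳ : ∀ {a b} (f : Hom a b) → f ∘ id ≡ f
    assoc     : ∀ {a b c d} (f : Hom a b) (g : Hom b c) (h : Hom c d) →
                (h ∘ g) ∘ f ≡ h ∘ (g ∘ f)

Rigid : Category → Set
Rigid J = ∀ {a : Obj} (f g : Hom a a) → f ∘ g ≡ id → g ∘ f ≡ id → f ≡ id
  where open Category J

record Functor (J : Category) : Set₁ where
  open Category J
  field
    F₀     : Obj → Set
    F₁     : ∀ {a b} → Hom a b → F₀ a → F₀ b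
    F-id   : ∀ {a} (x : F₀ a) → F₁ id x ≡ x
    F-comp : ∀ {a b c} (f : Hom a b) (g : Hom b c) (x : F₀ a) →
             F₁ (g ∘ f) x ≡ F₁ g (F₁ f x)

record NatTrans {J : Category} (F G : Functor J) : Set where
  open Category J
  open Functor
  field
    η       : ∀ a → F₀ F a → F₀ G a
    natural : ∀ {a b} (f : Hom a b) (x : F₀ F a) →
              η b (F₁ F f x) ≡ F₁ G f (η a x)

module _ {J : Category} where
  open NatTrans
  open Functor

  idNT : {F : Functor J} → NatTrans F F
  idNT = record { η = λ a x → x ; natural = λ f x → refl }

  infixr 9 _∘NT_
  _∘NT_ : {F G H : Functor J} → NatTrans G H → NatTrans F G → NatTrans F H
  _∘NT_ {F} {G} {H} β α = record
    { η = λ a x → η β a (η α a x)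
    ; natural = λ f x → trans (cong (η β _) (natural α f x)) (natural β f (η α _ x)) }

  infix 4 _≈NT_
  _≈NT_ : {F G : Functor J} → NatTrans F G → NatTrans F G → Set
  α ≈NT β = ∀ a x → η α a x ≡ η β a x

-- An element of the covariant isotropy group Z(F) of Set^J at F:
-- a natural automorphism of the projection functor F/Set^J → Set^J,
-- i.e. for each m : F → G an automorphism α_m : G → G (with inverse),
-- natural in morphisms n : (G, m) → (H, m') of the coslice
-- (n ∘ m ≈ m'):  α_{m'} ∘ n ≈ n ∘ α_m.
record IsotropyElement {J : Category} (F : Functor J) : Set₂ where
  field
    comp     : ∀ {G : Functor J} → NatTrans F G → NatTrans G G
    inv      : ∀ {G : Functor J} → NatTrans F G → NatTrans G G
    inv-l    : ∀ {G : Functor J} (m : NatTrans F G) → inv m ∘NT comp m ≈NT idNT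
    inv-r    : ∀ {G : Functor J} (m : NatTrans F G) → comp m ∘NT inv m ≈NT idNT
    natural  : ∀ {G H : Functor J} (m : NatTrans F G) (m' : NatTrans F H)
               (n : NatTrans G H) → n ∘NT m ≈NT m' →
               comp m' ∘NT n ≈NT n ∘NT comp m

TrivialIsotropy : {J : Category} → Functor J → Set₂
TrivialIsotropy {J} F =
  (α : IsotropyElement F) → ∀ {G : Functor J} (m : NatTrans F G) →
  IsotropyElement.comp α m ≈NT idNT

module Submission where

open import Defs
open import Data.Sum using (_⊎_; inj₁; inj₂)
open import Data.Sum.Properties using (inj₂-injective)
open import Data.Product using (∃; _,_)
open import Relation.Binary.PropositionalEquality using (_≡_; refl; sym; trans; cong; module ≡-Reasoning)

-- Given m : F → G and x ∈ G(a), glue the representable Hom(a, -) onto G.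
-- Naturality of an isotropy element along the inclusion G → G + Hom(a, -)
-- shows that its component there preserves both summands, so on Hom(a, -)
-- it is, by Yoneda, precomposition with an automorphism of a, which is the
-- identity by rigidity. Naturality along the map G + Hom(a, -) → G that
-- sends id_a to x then forces the component at m to fix x.

module _ {J : Category} where
  open Category J
  open Functor
  open NatTrans

  infixr 6 _⊕_
  _⊕_ : Functor J → Functor J → Functor J
  G ⊕ H = record
    { F₀     = λ b → F₀ G b ⊎ F₀ H b
    ; F₁     = λ { f (inj₁ y) → inj₁ (F₁ G f y) ; f (inj₂ z) → inj₂ (F₁ H f z) }
    ; F-id   = λ { (inj₁ y) → cong inj₁ (F-id G y) ; (inj₂ z) → cong inj₂ (F-id H z) }
    ; F-comp = λ { f g (inj₁ y) → cong inj₁ (F-comp G f g y)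
                 ; f g (inj₂ z) → cong inj₂ (F-comp H f g z) } }

  Representable : Obj → Functor J
  Representable a = record
    { F₀     = Hom a
    ; F₁     = _∘_
    ; F-id   = identityˡ
    ; F-comp = λ f g h → assoc h f g }

  ι₁ : {G H : Functor J} → NatTrans G (G ⊕ H)
  ι₁ = record { η = λ b → inj₁ ; natural = λ f y → refl }

  [_,_] : {G H K : Functor J} → NatTrans G K → NatTrans H K → NatTrans (G ⊕ H) K
  [ μ , ν ] = record
    { η       = λ { b (inj₁ y) → η μ b y ; b (inj₂ z) → η ν b z }
    ; natural = λ { f (inj₁ y) → natural μ f y ; f (inj₂ z) → natural ν f z } }

  yoneda : (G : Functor J) {a : Obj} → F₀ G a → NatTrans (Representable a) G
  yoneda G x = record { η = λ b f → F₁ G f x ; natural = λ f g → F-comp G g f x }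

  inverse-commutes : {G S : Functor J} (ι : NatTrans G S) {P Q : NatTrans S S}
                     {γ δ : NatTrans G G} →
                     P ∘NT ι ≈NT ι ∘NT γ → Q ∘NT P ≈NT idNT → γ ∘NT δ ≈NT idNT →
                     Q ∘NT ι ≈NT ι ∘NT δ
  inverse-commutes ι {P} {Q} {γ} {δ} Pι QP γδ b y = begin
    η Q b (η ι b y)                     ≡⟨ cong (λ y′ → η Q b (η ι b y′)) (sym (γδ b y)) ⟩
    η Q b (η ι b (η γ b (η δ b y)))     ≡⟨ cong (η Q b) (sym (Pι b (η δ b y))) ⟩
    η Q b (η P b (η ι b (η δ b y)))     ≡⟨ QP b (η ι b (η δ b y)) ⟩
    η ι b (η δ b y)                     ∎
    where open ≡-Reasoning

  keeps-inj₂ : {G H : Functor J} {P Q : NatTrans (G ⊕ H) (G ⊕ H)} {δ : NatTrans G G} →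
               Q ∘NT ι₁ ≈NT ι₁ ∘NT δ → Q ∘NT P ≈NT idNT →
               ∀ b z → ∃ λ z′ → η P b (inj₂ z) ≡ inj₂ z′
  keeps-inj₂ {P = P} {Q} Qι QP b z with η P b (inj₂ z) in eq
  ... | inj₂ z′ = z′ , refl
  -- otherwise Q would send inj₁ y back to inj₂ z
  ... | inj₁ y with () ← trans (sym (Qι b y)) (trans (cong (η Q b) (sym eq)) (QP b (inj₂ z)))

  yoneda-action : {G : Functor J} {a : Obj}
                  (P : NatTrans (G ⊕ Representable a) (G ⊕ Representable a))
                  {h : Hom a a} → η P a (inj₂ id) ≡ inj₂ h →
                  ∀ {b} (k : Hom a b) → η P b (inj₂ k) ≡ inj₂ (k ∘ h)
  yoneda-action {G} {a} P {h} Pid {b} k = begin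
    η P b (inj₂ k)                ≡⟨ cong (λ k′ → η P b (inj₂ k′)) (sym (identityʳ k)) ⟩
    η P b (inj₂ (k ∘ id))         ≡⟨ natural P k (inj₂ id) ⟩
    F₁ S k (η P a (inj₂ id))      ≡⟨ cong (F₁ S k) Pid ⟩
    inj₂ (k ∘ h)                  ∎
    where
      open ≡-Reasoning
      S = G ⊕ Representable a

  automorphism-fixes-generator :
    Rigid J → {G : Functor J} {a : Obj}
    (P Q : NatTrans (G ⊕ Representable a) (G ⊕ Representable a)) (γ δ : NatTrans G G) →
    P ∘NT ι₁ ≈NT ι₁ ∘NT γ → Q ∘NT P ≈NT idNT → P ∘NT Q ≈NT idNT → γ ∘NT δ ≈NT idNT →
    η P a (inj₂ id) ≡ inj₂ id
  automorphism-fixes-generator rigid {a = a} P Q γ δ Pι QP PQ γδ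
    with keeps-inj₂ {P = P} {Q} {δ} Qι QP a id | keeps-inj₂ {P = Q} {P} {γ} Pι PQ a id
    where Qι = inverse-commutes ι₁ {P} {Q} {γ} {δ} Pι QP γδ
  ... | h , Pid | k , Qid = trans Pid (cong inj₂ (rigid h k hk≡id kh≡id))
    where
      hk≡id : h ∘ k ≡ id
      hk≡id = inj₂-injective (begin
        inj₂ (h ∘ k)             ≡⟨ sym (yoneda-action Q Qid h) ⟩
        η Q a (inj₂ h)           ≡⟨ cong (η Q a) (sym Pid) ⟩
        η Q a (η P a (inj₂ id))  ≡⟨ QP a (inj₂ id) ⟩
        inj₂ id                  ∎)
        where open ≡-Reasoning
      kh≡id : k ∘ h ≡ id
      kh≡id = inj₂-injective (begin
        inj₂ (k ∘ h)             ≡⟨ sym (yoneda-action P Pid k) ⟩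
        η P a (inj₂ k)           ≡⟨ cong (η P a) (sym Qid) ⟩
        η P a (η Q a (inj₂ id))  ≡⟨ PQ a (inj₂ id) ⟩
        inj₂ id                  ∎)
        where open ≡-Reasoning

proposition24 : (J : Category) → Rigid J → (F : Functor J) → TrivialIsotropy F
proposition24 J rigid F α {G} m a x = begin
  η γ a x                  ≡⟨ cong (η γ a) (sym (F-id G x)) ⟩
  η γ a (η n a (inj₂ id))  ≡⟨ α.natural m′ m n (λ _ _ → refl) a (inj₂ id) ⟩
  η n a (η β a (inj₂ id))  ≡⟨ cong (η n a) β-fixes-id ⟩
  η n a (inj₂ id)          ≡⟨ F-id G x ⟩
  x                        ∎
  where
    open Category J using (id)
    open Functor using (F-id)
    open NatTrans using (η)
    open ≡-Reasoning
    module α = IsotropyElement α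
    S : Functor J
    S = G ⊕ Representable a
    m′ : NatTrans F S
    m′ = ι₁ ∘NT m
    n : NatTrans S G
    n = [ idNT , yoneda G x ]
    β : NatTrans S S
    β = α.comp m′
    γ : NatTrans G G
    γ = α.comp m
    β-fixes-id : η β a (inj₂ id) ≡ inj₂ id
    β-fixes-id = automorphism-fixes-generator rigid β (α.inv m′) γ (α.inv m)
      (α.natural m m′ ι₁ (λ _ _ → refl)) (α.inv-l m′) (α.inv-r m′) (α.inv-r m)
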